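{- Let $(G',\langle R',B'\rangle,k')$ be an instance of \textsc{Red-Blue Dominating Set} in which $G'$ has no isolated vertex, and let $(G,k)$ be the instance of \textsc{Locating-Dominating Set} constructed from it as described below. Then $(G',\langle R',B'\rangle,k')$ is a yes-instance of \textsc{Red-Blue Dominating Set} if and only if $(G,k)$ is a yes-instance of \textsc{Locating-Dominating Set}.
   Context: \textsc{Red-Blue Dominating Set}: given a bipartite graph $G'$ with bipartition $\langle R',B'\rangle$ and an integer $k'$, decide whether there is $S'\subseteq R'$ with $|S'|\le k'$ and $B'\subseteq N(S')$. A locating-dominating set of a graph $G$ is a dominating set $S$ such that distinct $u,v\in V(G)\setminus S$ satisfy $N(u)\cap S\ne N(v)\cap S$; \textsc{Locating-Dominating Set} asks, given $(G,k)$, whether $G$ has one of size at most $k$. Construction: write $R'=\{r'_1,\dots,r'_{|R'|}\}$, $B'=\{b'_1,\dots,b'_{|B'|}\}$. The graph $G$ has vertices $r_i$ ($i\in[|R'|]$) and $b^{\circ}_j,b^{\star}_j$ ($j\in[|B'|]$). Let $q=\lceil\log_2|R'|\rceil+1$; for each $i\in\{0,1,\dots,q\}$ add vertices $y_{i,1},y_{i,2}$ and the edge $y_{i,1}y_{i,2}$; for each $\ell\in[|R'|]$, make $r_\ell$ adjacent to $y_{i,1}$ ($i\in[q]$) iff the $i$-th bit of the $q$-bit binary representation of $\ell$ is $1$, and make every $r_\ell$ adjacent to $y_{0,1}$. Let $p=\lceil\log_2|B'|\rceil+1$; for each $i\in\{0,1,\dots,p\}$ add vertices $z_{i,1},z_{i,2}$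 and the edge $z_{i,1}z_{i,2}$; for each $j\in[|B'|]$, make both $b^{\circ}_j$ and $b^{\star}_j$ adjacent to $z_{i,1}$ ($i\in[p]$) iff the $i$-th bit of the $p$-bit binary representation of $j$ is $1$, and make all $b^{\circ}_j,b^{\star}_j$ adjacent to $z_{0,1}$. Finally, for all $i,j$: if $r'_i b'_j\notin E(G')$ add the edges $r_ib^{\circ}_j$ and $r_ib^{\star}_j$; if $r'_ib'_j\in E(G')$ add only the edge $r_ib^{\circ}_j$. There are no other edges. Set $k=k'+(q+1)+(p+1)$. -}

module Defs where

open import Data.Nat using (ℕ; zero; suc; _+_; _≤_; _/_; _%_; _^_)
open import Data.Nat.Properties using (m^n≢0)
open import Data.Nat.Logarithm using (⌈log₂_⌉)
open import Data.Nat using (_≡ᵇ_)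
open import Data.Bool using (Bool; true; false; _∨_; not; T)
open import Data.Fin using (Fin; toℕ) renaming (zero to fzero; suc to fsuc)
open import Data.List using (List; length)
open import Data.List.Membership.Propositional using (_∈_)
open import Data.List.Relation.Unary.Unique.Propositional using (Unique)
open import Data.Product using (Σ; ∃; _×_; _,_)
open import Data.Sum using (_⊎_)
open import Relation.Nullary using (¬_)
open import Relation.Binary.PropositionalEquality using (_≡_)

-- Red-Blue Dominating Set
-- A bipartite graph G' with parts R' = Fin nR and B' = Fin nB, given by
-- its bipartite adjacency E r b (true iff r'b' is an edge).

record BipGraph : Set where
  field
    nR : ℕ
    nB : ℕ
    E  : Fin nR → Fin nB → Bool
open BipGraph public

NoIsolated : BipGraph → Set
NoIsolated G' =
  (∀ (r : Fin (nR G')) → ∃ λ (b : Fin (nB G')) → T (E G' r b)) ×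
  (∀ (b : Fin (nB G')) → ∃ λ (r : Fin (nR G')) → T (E G' r b))

IsRBDS : (G' : BipGraph) → List (Fin (nR G')) → ℕ → Set
IsRBDS G' S k' =
  Unique S × length S ≤ k' ×
  (∀ (b : Fin (nB G')) → ∃ λ r → r ∈ S × T (E G' r b))

RBDSYes : BipGraph → ℕ → Set
RBDSYes G' k' = ∃ λ (S : List (Fin (nR G'))) → IsRBDS G' S k'

record Graph : Set₁ where
  field
    V   : Set
    Adj : V → V → Set
open Graph public

Dominating : (G : Graph) → List (V G) → Set
Dominating G S = ∀ (v : V G) → ¬ (v ∈ S) → ∃ λ u → u ∈ S × Adj G u v

Locating : (G : Graph) → List (V G) → Set
Locating G S = ∀ (u v : V G) → ¬ (u ∈ S) → ¬ (v ∈ S) → ¬ (u ≡ v) →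
  ¬ (∀ (w : V G) → w ∈ S → ((Adj G u w → Adj G v w) × (Adj G v w → Adj G u w)))

IsLDS : (G : Graph) → List (V G) → ℕ → Set
IsLDS G S k = Unique S × length S ≤ k × Dominating G S × Locating G S

LDSYes : Graph → ℕ → Set
LDSYes G k = ∃ λ (S : List (V G)) → IsLDS G S k

-- bit i (0-based, least significant first) of n is 1.
-- The paper's "i-th bit" for i ∈ [q] is bit (i-1) here.
bit : ℕ → ℕ → Bool
bit n i = ((n / (2 ^ i)) {{m^n≢0 2 i}} % 2) ≡ᵇ 1

qOf : ℕ → ℕ
qOf n = ⌈log₂ n ⌉ + 1

-- vertices of G; index of r, b°, b⋆ is ℓ-1 (resp. j-1);
-- y₁ i, y₂ i, z₁ i, z₂ i for i ∈ {0,…,q} resp. {0,…,p}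
data CVtx (nR nB : ℕ) : Set where
  r   : Fin nR → CVtx nR nB
  b°  : Fin nB → CVtx nR nB
  b⋆  : Fin nB → CVtx nR nB
  y₁  : Fin (suc (qOf nR)) → CVtx nR nB
  y₂  : Fin (suc (qOf nR)) → CVtx nR nB
  z₁  : Fin (suc (qOf nB)) → CVtx nR nB
  z₂  : Fin (suc (qOf nB)) → CVtx nR nB

-- one orientation of each edge
edge : (G' : BipGraph) → CVtx (nR G') (nB G') → CVtx (nR G') (nB G') → Bool
edge G' (y₁ i) (y₂ i') = toℕ i ≡ᵇ toℕ i'
edge G' (z₁ i) (z₂ i') = toℕ i ≡ᵇ toℕ i'
edge G' (r ℓ) (y₁ fzero) = true
edge G' (r ℓ) (y₁ (fsuc i)) = bit (suc (toℕ ℓ)) (toℕ i)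
edge G' (b° j) (z₁ fzero) = true
edge G' (b° j) (z₁ (fsuc i)) = bit (suc (toℕ j)) (toℕ i)
edge G' (b⋆ j) (z₁ fzero) = true
edge G' (b⋆ j) (z₁ (fsuc i)) = bit (suc (toℕ j)) (toℕ i)
edge G' (r i) (b° j) = true
edge G' (r i) (b⋆ j) = not (E G' i j)
edge G' _ _ = false

construct : BipGraph → Graph
construct G' = record
  { V   = CVtx (nR G') (nB G')
  ; Adj = λ u v → T (edge G' u v ∨ edge G' v u)
  }

constructK : BipGraph → ℕ → ℕ
constructK G' k' = k' + suc (qOf (nR G')) + suc (qOf (nB G'))

module Submission where

-- (⇒) Given a red-blue dominating set S', take S = S' ∪ {y_{i,1}} ∪ {z_{i,1}}. The vertex y_{0,1} separates
-- every r-vertex from all vertices other than r-vertices and y_{0,2}, and a pendant y_{i,2} is separated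
-- from every vertex that is not an r-vertex by its unique neighbour y_{i,1}; likewise on the z-side. The remaining pairs
-- (two r-vertices, or an r-vertex and y_{0,2}) have different 1-based indices below 2^q (counting y_{0,2}
-- as 0), so some y_{i+1,1} sees a bit in which they differ; likewise for b-vertices and z_{0,2}. The only
-- pair left, b°_j and b⋆_j, is separated by a vertex of S' dominating b'_j.
-- (⇐) Each pendant y_{i,2} (z_{i,2}) forces y_{i,1} or y_{i,2} (z_{i,1} or z_{i,2}) into S, so at most k'
-- vertices of S are r-, b°- or b⋆-vertices. Replacing b°_j and b⋆_j by a red neighbour of b'_j gives a red
-- set of size at most k'. It dominates b'_j, for otherwise b°_j and b⋆_j, whose neighbourhoods differ only
-- on the red neighbours of b'_j, would not be located.

open import Defs
open import Data.Nat using (ℕ)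
open import Function.Bundles using (_⇔_)

open import Data.Bool using (Bool; true; false; T; not; _∨_)
import Data.Bool as Bool
open import Data.Bool.Properties using (∨-identityʳ; T-∨)
open import Data.Empty using (⊥-elim)
open import Data.Fin using (Fin; toℕ; join; splitAt) renaming (zero to fzero; suc to fsuc)
open import Data.Fin.Properties using (toℕ-injective; toℕ<n; ¬∀⟶∃¬; injective⇒≤; join-splitAt)
  renaming (_≟_ to _≟ᶠ_)
open import Data.List using (List; []; _∷_; _++_; map; tabulate; lookup; length; mapMaybe; deduplicate)
open import Data.List.Properties using (length-++; length-map; length-tabulate; length-deduplicate)
open import Data.List.Membership.Propositional using (_∈_; lose; find)
open import Data.List.Membership.Propositional.Properties
  using (∈-map⁺; ∈-map⁻; ∈-++⁺ˡ; ∈-++⁺ʳ; ∈-++⁻; ∈-tabulate⁺; ∈-tabulate⁻; ∈-deduplicate⁺)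
open import Data.List.Relation.Binary.Disjoint.Propositional using (Disjoint)
open import Data.List.Relation.Unary.Any using (Any; any?)
import Data.List.Relation.Unary.Any as Any
import Data.List.Relation.Unary.Any.Properties as Any
open import Data.List.Relation.Unary.Unique.Propositional using (Unique)
import Data.List.Relation.Unary.Unique.Propositional.Properties as Unique
open import Data.List.Relation.Unary.Unique.DecPropositional.Properties using (deduplicate-!)
open import Data.Maybe using (Maybe; just)
import Data.Maybe.Relation.Unary.Any as Maybe
open import Data.Nat using (zero; suc; _+_; _*_; _^_; _≤_; _<_; z≤n; s≤s; _/_; _%_; _≡ᵇ_; ⌈_/2⌉)
open import Data.Nat.DivMod using (n/1≡n; 0/n≡0; m/n/o≡m/[n*o]; m<n*o⇒m/o<n; m≡m%n+[m/n]*n; m%n<n)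
open import Data.Nat.Induction using (Acc; acc; <-wellFounded)
open import Data.Nat.Logarithm using (⌈log₂_⌉)
open import Data.Nat.Logarithm.Core using (⌈log2⌉)
open import Data.Nat.Properties
open import Data.Product using (∃; _×_; _,_; proj₁; proj₂; uncurry)
open import Data.Sum using (_⊎_; inj₁; inj₂; isInj₁; isInj₂)
import Data.Sum.Properties as Sum
open import Function using (_∘_; id; flip)
open import Function.Bundles using (mk⇔; Equivalence)
open import Level using (0ℓ)
open import Relation.Binary.PropositionalEquality
open import Relation.Nullary using (¬_; yes; no)
open import Relation.Nullary.Decidable using (T?)
open import Relation.Unary using (Pred; Decidable)

T-injective : ∀ {x y} → (T x → T y) → (T y → T x) → x ≡ y
T-injective {false} {false} _ _ = refl
T-injective {false} {true}  _ g = ⊥-elim (g _)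
T-injective {true}  {false} f _ = ⊥-elim (f _)
T-injective {true}  {true}  _ _ = refl

T⇒true≢not : ∀ {x} → T x → true ≢ not x
T⇒true≢not {true} _ ()

≡ᵇ-refl : ∀ n → T (n ≡ᵇ n)
≡ᵇ-refl n = ≡⇒≡ᵇ n n refl

toℕ-≡ᵇ⇒≡ : ∀ {n} {i j : Fin n} → T (toℕ i ≡ᵇ toℕ j) → i ≡ j
toℕ-≡ᵇ⇒≡ = toℕ-injective ∘ ≡ᵇ⇒≡ _ _

¬T⇒T-not : ∀ {x} → ¬ T x → T (not x)
¬T⇒T-not {false} _ = _
¬T⇒T-not {true}  ¬t = ¬t _

≤2^⌈log2⌉ : ∀ n (rec : Acc _<_ n) → n ≤ 2 ^ ⌈log2⌉ n rec
≤2^⌈log2⌉ 0 _ = z≤n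
≤2^⌈log2⌉ 1 _ = s≤s z≤n
≤2^⌈log2⌉ (suc (suc n)) (acc rs) = begin
  2 + n          ≤⟨ +-monoʳ-≤ 2 n≤c+c ⟩
  2 + (c + c)    ≡⟨ cong suc (sym (+-suc c c)) ⟩
  suc c + suc c  ≤⟨ +-mono-≤ ih ih ⟩
  2 ^ L + 2 ^ L  ≡⟨ cong (2 ^ L +_) (sym (+-identityʳ (2 ^ L))) ⟩
  2 ^ suc L      ∎
  where
  open ≤-Reasoning
  c L : ℕ
  c = ⌈ n /2⌉
  L = ⌈log2⌉ (suc c) (rs _)
  ih : suc c ≤ 2 ^ L
  ih = ≤2^⌈log2⌉ (suc c) (rs _)
  n≤c+c : n ≤ c + c
  n≤c+c = subst (_≤ c + c) (⌊n/2⌋+⌈n/2⌉≡n n) (+-monoˡ-≤ c (⌊n/2⌋≤⌈n/2⌉ n))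

n≤2^⌈log₂n⌉ : ∀ n → n ≤ 2 ^ ⌈log₂ n ⌉
n≤2^⌈log₂n⌉ n = ≤2^⌈log2⌉ n (<-wellFounded n)

bit-of-0 : ∀ i → bit 0 i ≡ false
bit-of-0 i = cong (λ m → m % 2 ≡ᵇ 1) (0/n≡0 (2 ^ i) {{m^n≢0 2 i}})

bit-zeroth : ∀ n → bit n 0 ≡ (n % 2 ≡ᵇ 1)
bit-zeroth n = cong (λ m → m % 2 ≡ᵇ 1) (n/1≡n n)

bit-suc : ∀ n i → bit n (suc i) ≡ bit (n / 2) i
bit-suc n i = cong (λ m → m % 2 ≡ᵇ 1)
  (sym (m/n/o≡m/[n*o] n 2 (2 ^ i) {{_}} {{m^n≢0 2 i}} {{m^n≢0 2 (suc i)}}))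

≡ᵇ1-injective : ∀ {m n} → m < 2 → n < 2 → (m ≡ᵇ 1) ≡ (n ≡ᵇ 1) → m ≡ n
≡ᵇ1-injective {0} {0} _ _ _ = refl
≡ᵇ1-injective {1} {1} _ _ _ = refl
≡ᵇ1-injective {0} {1} _ _ ()
≡ᵇ1-injective {1} {0} _ _ ()
≡ᵇ1-injective {suc (suc _)} (s≤s (s≤s ())) _ _
≡ᵇ1-injective {_} {suc (suc _)} _ (s≤s (s≤s ())) _

bits-injective : ∀ q {m n} → m < 2 ^ q → n < 2 ^ q →
                 (∀ (i : Fin q) → bit m (toℕ i) ≡ bit n (toℕ i)) → m ≡ n
bits-injective zero m<1 n<1 _ = trans (n<1⇒n≡0 m<1) (sym (n<1⇒n≡0 n<1))
bits-injective (suc q) {m} {n} m<2^q n<2^q same = begin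
  m                 ≡⟨ m≡m%n+[m/n]*n m 2 ⟩
  m % 2 + m / 2 * 2 ≡⟨ cong₂ (λ x y → x + y * 2) lowest rest ⟩
  n % 2 + n / 2 * 2 ≡⟨ sym (m≡m%n+[m/n]*n n 2) ⟩
  n                 ∎
  where
  open ≡-Reasoning
  lowest : m % 2 ≡ n % 2
  lowest = ≡ᵇ1-injective (m%n<n m 2) (m%n<n n 2)
             (trans (sym (bit-zeroth m)) (trans (same fzero) (bit-zeroth n)))
  halve : ∀ {k} → k < 2 ^ suc q → k / 2 < 2 ^ q
  halve {k} k< = m<n*o⇒m/o<n (subst (k <_) (*-comm 2 (2 ^ q)) k<)
  rest : m / 2 ≡ n / 2
  rest = bits-injective q (halve m<2^q) (halve n<2^q)
           (λ i → trans (sym (bit-suc m (toℕ i))) (trans (same (fsuc i)) (bit-suc n (toℕ i))))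

differing-bit : ∀ q {m n} → m < 2 ^ q → n < 2 ^ q → m ≢ n →
                ∃ λ (i : Fin q) → bit m (toℕ i) ≢ bit n (toℕ i)
differing-bit q m< n< m≢n =
  ¬∀⟶∃¬ q _ (λ i → bit _ (toℕ i) Bool.≟ bit _ (toℕ i)) (m≢n ∘ bits-injective q m< n<)

oneBased : ∀ {n} → Fin n → ℕ
oneBased ℓ = suc (toℕ ℓ)

oneBased-injective : ∀ {n} {ℓ ℓ' : Fin n} → oneBased ℓ ≡ oneBased ℓ' → ℓ ≡ ℓ'
oneBased-injective = toℕ-injective ∘ suc-injective

oneBased<2^qOf : ∀ {n} (ℓ : Fin n) → oneBased ℓ < 2 ^ qOf n
oneBased<2^qOf {n} ℓ = begin-strict
  oneBased ℓ       ≤⟨ toℕ<n ℓ ⟩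
  n                ≤⟨ n≤2^⌈log₂n⌉ n ⟩
  2 ^ ⌈log₂ n ⌉    <⟨ ^-monoʳ-< 2 (s≤s (s≤s z≤n)) (m<m+n ⌈log₂ n ⌉ (s≤s z≤n)) ⟩
  2 ^ qOf n        ∎
  where open ≤-Reasoning

module _ {A B : Set} where

  ∈-mapMaybe⁺ : ∀ (f : A → Maybe B) {x y xs} → x ∈ xs → f x ≡ just y → y ∈ mapMaybe f xs
  ∈-mapMaybe⁺ f {xs = xs} x∈xs fx≡just =
    Any.mapMaybe⁺ f xs (Any.map⁺ (Any.map (λ { refl → subst (Maybe.Any _) (sym fx≡just) (Maybe.just refl) })
                                          x∈xs))

  length-mapMaybe-isInj : ∀ (xs : List (A ⊎ B)) →
                          length xs ≡ length (mapMaybe isInj₁ xs) + length (mapMaybe isInj₂ xs)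
  length-mapMaybe-isInj []            = refl
  length-mapMaybe-isInj (inj₁ _ ∷ xs) = cong suc (length-mapMaybe-isInj xs)
  length-mapMaybe-isInj (inj₂ _ ∷ xs) = trans (cong suc (length-mapMaybe-isInj xs)) (sym (+-suc _ _))

∀∈⇒≤length : ∀ {n} {xs : List (Fin n)} → (∀ i → i ∈ xs) → n ≤ length xs
∀∈⇒≤length {xs = xs} ∈xs = injective⇒≤ λ {i} {j} eq →
  trans (Any.lookup-index (∈xs i)) (trans (cong (lookup xs) eq) (sym (Any.lookup-index (∈xs j))))

AgreeAt : (G : Graph) → V G → V G → V G → Set
AgreeAt G w u v = (Adj G u w → Adj G v w) × (Adj G v w → Adj G u w)

module _ (G : Graph) {S : List (V G)} where

  dominating⇒meets : Dominating G S → {P : Pred (V G) 0ℓ} → Decidable P →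
                     ∀ {v} → P v → (∀ {u} → Adj G u v → P u) → Any P S
  dominating⇒meets dom P? {v} Pv nbhd with any? P? S
  ... | yes meets = meets
  ... | no misses = let u , u∈S , uv = dom v (misses ∘ flip lose Pv) in
                    ⊥-elim (misses (lose u∈S (nbhd uv)))

  locating⇒meets : Locating G S → {P : Pred (V G) 0ℓ} → Decidable P →
                   ∀ {u v} → u ≢ v → P u → P v →
                   (∀ w → ¬ P w → AgreeAt G w u v) → Any P S
  locating⇒meets loc P? {u} {v} u≢v Pu Pv agree with any? P? S
  ... | yes meets = meets
  ... | no misses = ⊥-elim (loc u v (misses ∘ flip lose Pu) (misses ∘ flip lose Pv) u≢v
                                   (λ w w∈S → agree w (misses ∘ lose w∈S)))

module Forward (G' : BipGraph) (S' : List (Fin (nR G'))) where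

  G : Graph
  G = construct G'

  Vertex : Set
  Vertex = CVtx (nR G') (nB G')

  qR qB : ℕ
  qR = qOf (nR G')
  qB = qOf (nB G')

  Ys Zs : List Vertex
  Ys = tabulate y₁
  Zs = tabulate z₁

  S : List Vertex
  S = map r S' ++ Ys ++ Zs

  r∈S : ∀ {ℓ} → ℓ ∈ S' → r ℓ ∈ S
  r∈S = ∈-++⁺ˡ ∘ ∈-map⁺ r

  y₁∈S : ∀ i → y₁ i ∈ S
  y₁∈S i = ∈-++⁺ʳ (map r S') (∈-++⁺ˡ (∈-tabulate⁺ {f = y₁} i))

  z₁∈S : ∀ i → z₁ i ∈ S
  z₁∈S i = ∈-++⁺ʳ (map r S') (∈-++⁺ʳ Ys (∈-tabulate⁺ {f = z₁} i))

  S-unique : Unique S' → Unique S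
  S-unique S'-unique =
    Unique.++⁺ (Unique.map⁺ (λ { refl → refl }) S'-unique)
               (Unique.++⁺ (Unique.tabulate⁺ {f = y₁} (λ { refl → refl }))
                           (Unique.tabulate⁺ {f = z₁} (λ { refl → refl }))
                           y≢z)
               r≢yz
    where
    y≢z : Disjoint Ys Zs
    y≢z (v∈y , v∈z) with ∈-tabulate⁻ {f = y₁} v∈y | ∈-tabulate⁻ {f = z₁} v∈z
    ... | _ , refl | _ , ()
    r≢yz : Disjoint (map r S') (Ys ++ Zs)
    r≢yz (v∈r , v∈yz) with ∈-map⁻ r v∈r | ∈-++⁻ Ys v∈yz
    ... | _ , _ , refl | inj₁ v∈y with () ← proj₂ (∈-tabulate⁻ {f = y₁} v∈y)
    ... | _ , _ , refl | inj₂ v∈z with () ← proj₂ (∈-tabulate⁻ {f = z₁} v∈z)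

  S-length : length S ≡ length S' + (suc qR + suc qB)
  S-length = begin
    length S                                ≡⟨ length-++ (map r S') ⟩
    length (map r S') + length (Ys ++ Zs)   ≡⟨ cong₂ _+_ (length-map r S') (length-++ Ys) ⟩
    length S' + (length Ys + length Zs)     ≡⟨ cong (length S' +_) (cong₂ _+_ (length-tabulate {A = Vertex} y₁)
                                                                               (length-tabulate {A = Vertex} z₁)) ⟩
    length S' + (suc qR + suc qB)           ∎
    where open ≡-Reasoning

  S-dominating : Dominating G S
  S-dominating (r _)  _ = y₁ fzero , y₁∈S fzero , _
  S-dominating (b° _) _ = z₁ fzero , z₁∈S fzero , _
  S-dominating (b⋆ _) _ = z₁ fzero , z₁∈S fzero , _
  S-dominating (y₂ i) _ =
    y₁ i , y₁∈S i , Equivalence.from (T-∨ {toℕ i ≡ᵇ toℕ i}) (inj₁ (≡ᵇ-refl (toℕ i)))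
  S-dominating (z₂ i) _ =
    z₁ i , z₁∈S i , Equivalence.from (T-∨ {toℕ i ≡ᵇ toℕ i}) (inj₁ (≡ᵇ-refl (toℕ i)))
  S-dominating (y₁ i) v∉S = ⊥-elim (v∉S (y₁∈S i))
  S-dominating (z₁ i) v∉S = ⊥-elim (v∉S (z₁∈S i))

  adj : Vertex → Vertex → Bool
  adj u v = edge G' u v ∨ edge G' v u

  data Separated (u v : Vertex) : Set where
    separated-by : ∀ w → w ∈ S → adj u w ≢ adj v w → Separated u v

  separated-sym : ∀ {u v} → Separated u v → Separated v u
  separated-sym (separated-by w w∈S differ) = separated-by w w∈S (differ ∘ sym)

  separated⇒¬same : ∀ {u v} → Separated u v → ¬ (∀ w → w ∈ S → AgreeAt G w u v)
  separated⇒¬same (separated-by w w∈S differ) same = differ (uncurry T-injective (same w w∈S))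

  by-y₁ : ∀ {u v} i → adj u (y₁ i) ≢ adj v (y₁ i) → Separated u v
  by-y₁ i = separated-by (y₁ i) (y₁∈S i)

  by-z₁ : ∀ {u v} i → adj u (z₁ i) ≢ adj v (z₁ i) → Separated u v
  by-z₁ i = separated-by (z₁ i) (z₁∈S i)

  by-pendant-y : ∀ i {v} → ¬ T (adj v (y₁ i)) → Separated (y₂ i) v
  by-pendant-y i ¬adj = by-y₁ i (λ e → ¬adj (subst T e (≡ᵇ-refl (toℕ i))))

  by-pendant-z : ∀ i {v} → ¬ T (adj v (z₁ i)) → Separated (z₂ i) v
  by-pendant-z i ¬adj = by-z₁ i (λ e → ¬adj (subst T e (≡ᵇ-refl (toℕ i))))

  Encodes : ∀ {q} → (Fin q → Vertex) → Vertex → ℕ → Set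
  Encodes w u m = ∀ i → adj u (w i) ≡ bit m (toℕ i)

  by-codes : ∀ {q} (w : Fin q → Vertex) → (∀ i → w i ∈ S) → ∀ {u v m n} →
             Encodes w u m → Encodes w v n → m < 2 ^ q → n < 2 ^ q → m ≢ n → Separated u v
  by-codes w w∈S u-code v-code m< n< m≢n =
    let i , differ = differing-bit _ m< n< m≢n in
    separated-by (w i) (w∈S i) λ e → differ (trans (sym (u-code i)) (trans e (v-code i)))

  by-y-codes : ∀ {u v m n} → Encodes (y₁ ∘ fsuc) u m → Encodes (y₁ ∘ fsuc) v n →
               m < 2 ^ qR → n < 2 ^ qR → m ≢ n → Separated u v
  by-y-codes = by-codes (y₁ ∘ fsuc) (y₁∈S ∘ fsuc)

  by-z-codes : ∀ {u v m n} → Encodes (z₁ ∘ fsuc) u m → Encodes (z₁ ∘ fsuc) v n →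
               m < 2 ^ qB → n < 2 ^ qB → m ≢ n → Separated u v
  by-z-codes = by-codes (z₁ ∘ fsuc) (z₁∈S ∘ fsuc)

  r-code : ∀ ℓ → Encodes (y₁ ∘ fsuc) (r ℓ) (oneBased ℓ)
  r-code ℓ _ = ∨-identityʳ _

  b°-code : ∀ j → Encodes (z₁ ∘ fsuc) (b° j) (oneBased j)
  b°-code j _ = ∨-identityʳ _

  b⋆-code : ∀ j → Encodes (z₁ ∘ fsuc) (b⋆ j) (oneBased j)
  b⋆-code j _ = ∨-identityʳ _

  y₂-code : Encodes (y₁ ∘ fsuc) (y₂ fzero) 0
  y₂-code = sym ∘ bit-of-0 ∘ toℕ

  z₂-code : Encodes (z₁ ∘ fsuc) (z₂ fzero) 0
  z₂-code = sym ∘ bit-of-0 ∘ toℕ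

  r-separated : ∀ ℓ v → r ℓ ≢ v → Separated (r ℓ) v
  r-separated ℓ (r ℓ') ne =
    by-y-codes (r-code ℓ) (r-code ℓ') (oneBased<2^qOf ℓ) (oneBased<2^qOf ℓ') (ne ∘ cong r ∘ oneBased-injective)
  r-separated ℓ (y₂ fzero) _ =
    by-y-codes (r-code ℓ) y₂-code (oneBased<2^qOf ℓ) (m^n>0 2 qR) (λ ())
  r-separated ℓ (y₂ (fsuc _)) _ = by-y₁ fzero (λ ())
  r-separated ℓ (b° _) _ = by-y₁ fzero (λ ())
  r-separated ℓ (b⋆ _) _ = by-y₁ fzero (λ ())
  r-separated ℓ (z₂ _) _ = by-y₁ fzero (λ ())
  r-separated ℓ (y₁ _) _ = by-y₁ fzero (λ ())
  r-separated ℓ (z₁ _) _ = by-y₁ fzero (λ ())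

  y₂-separated : ∀ i v → y₂ i ≢ v → Separated (y₂ i) v
  y₂-separated i (r ℓ) ne = separated-sym (r-separated ℓ (y₂ i) (ne ∘ sym))
  y₂-separated i (y₂ i') ne = by-pendant-y i (ne ∘ cong y₂ ∘ toℕ-≡ᵇ⇒≡)
  y₂-separated i (b° _) _ = by-pendant-y i (λ ())
  y₂-separated i (b⋆ _) _ = by-pendant-y i (λ ())
  y₂-separated i (z₂ _) _ = by-pendant-y i (λ ())
  y₂-separated i (y₁ _) _ = by-pendant-y i (λ ())
  y₂-separated i (z₁ _) _ = by-pendant-y i (λ ())

  z₂-separated : ∀ i v → z₂ i ≢ v → Separated (z₂ i) v
  z₂-separated i (z₂ i') ne = by-pendant-z i (ne ∘ cong z₂ ∘ toℕ-≡ᵇ⇒≡)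
  z₂-separated fzero (b° j) _ =
    by-z-codes z₂-code (b°-code j) (m^n>0 2 qB) (oneBased<2^qOf j) (λ ())
  z₂-separated fzero (b⋆ j) _ =
    by-z-codes z₂-code (b⋆-code j) (m^n>0 2 qB) (oneBased<2^qOf j) (λ ())
  z₂-separated (fsuc _) (b° _) _ = by-z₁ fzero (λ ())
  z₂-separated (fsuc _) (b⋆ _) _ = by-z₁ fzero (λ ())
  z₂-separated i (r _) _ = by-pendant-z i (λ ())
  z₂-separated i (y₂ _) _ = by-pendant-z i (λ ())
  z₂-separated i (y₁ _) _ = by-pendant-z i (λ ())
  z₂-separated i (z₁ _) _ = by-pendant-z i (λ ())

  blues-separated : ∀ {u v} {j j' : Fin (nB G')} → Encodes (z₁ ∘ fsuc) u (oneBased j) →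
                    Encodes (z₁ ∘ fsuc) v (oneBased j') → j ≢ j' → Separated u v
  blues-separated {j = j} {j'} u-code v-code j≢j' =
    by-z-codes u-code v-code (oneBased<2^qOf j) (oneBased<2^qOf j') (j≢j' ∘ oneBased-injective)

  module _ (S'-dominates : ∀ j → ∃ λ ℓ → ℓ ∈ S' × T (E G' ℓ j)) where

    twins-separated : ∀ j → Separated (b° j) (b⋆ j)
    twins-separated j = let ℓ , ℓ∈S' , ℓj = S'-dominates j in
                        separated-by (r ℓ) (r∈S ℓ∈S') (T⇒true≢not ℓj)

    b°-separated : ∀ j v → b° j ≢ v → Separated (b° j) v
    b°-separated j (b° j') ne = blues-separated (b°-code j) (b°-code j') (ne ∘ cong b°)
    b°-separated j (b⋆ j') _ with j ≟ᶠ j'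
    ... | yes refl = twins-separated j
    ... | no j≢j' = blues-separated (b°-code j) (b⋆-code j') j≢j'
    b°-separated j (r ℓ) ne = separated-sym (r-separated ℓ (b° j) (ne ∘ sym))
    b°-separated j (y₂ i) ne = separated-sym (y₂-separated i (b° j) (ne ∘ sym))
    b°-separated j (z₂ i) ne = separated-sym (z₂-separated i (b° j) (ne ∘ sym))
    b°-separated j (y₁ _) _ = by-z₁ fzero (λ ())
    b°-separated j (z₁ _) _ = by-z₁ fzero (λ ())

    b⋆-separated : ∀ j v → b⋆ j ≢ v → Separated (b⋆ j) v
    b⋆-separated j (b⋆ j') ne = blues-separated (b⋆-code j) (b⋆-code j') (ne ∘ cong b⋆)
    b⋆-separated j (b° j') ne = separated-sym (b°-separated j' (b⋆ j) (ne ∘ sym))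
    b⋆-separated j (r ℓ) ne = separated-sym (r-separated ℓ (b⋆ j) (ne ∘ sym))
    b⋆-separated j (y₂ i) ne = separated-sym (y₂-separated i (b⋆ j) (ne ∘ sym))
    b⋆-separated j (z₂ i) ne = separated-sym (z₂-separated i (b⋆ j) (ne ∘ sym))
    b⋆-separated j (y₁ _) _ = by-z₁ fzero (λ ())
    b⋆-separated j (z₁ _) _ = by-z₁ fzero (λ ())

    S-locating : Locating G S
    S-locating (r ℓ)  v _ _ ne = separated⇒¬same (r-separated ℓ v ne)
    S-locating (y₂ i) v _ _ ne = separated⇒¬same (y₂-separated i v ne)
    S-locating (z₂ i) v _ _ ne = separated⇒¬same (z₂-separated i v ne)
    S-locating (b° j) v _ _ ne = separated⇒¬same (b°-separated j v ne)
    S-locating (b⋆ j) v _ _ ne = separated⇒¬same (b⋆-separated j v ne)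
    S-locating (y₁ i) _ u∉S _ _ = ⊥-elim (u∉S (y₁∈S i))
    S-locating (z₁ i) _ u∉S _ _ = ⊥-elim (u∉S (z₁∈S i))

    S-isLDS : ∀ {k'} → Unique S' → length S' ≤ k' → IsLDS G S (constructK G' k')
    S-isLDS {k'} S'-unique S'-length = S-unique S'-unique , S-length≤ , S-dominating , S-locating
      where
      open ≤-Reasoning
      S-length≤ : length S ≤ constructK G' k'
      S-length≤ = begin
        length S                       ≡⟨ S-length ⟩
        length S' + (suc qR + suc qB)  ≤⟨ +-monoˡ-≤ _ S'-length ⟩
        k' + (suc qR + suc qB)         ≡⟨ sym (+-assoc k' _ _) ⟩
        constructK G' k'               ∎

module Backward (G' : BipGraph) (blue-not-isolated : ∀ j → ∃ λ ℓ → T (E G' ℓ j))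
                (S : List (CVtx (nR G') (nB G'))) where

  G : Graph
  G = construct G'

  Vertex : Set
  Vertex = CVtx (nR G') (nB G')

  Q P : ℕ
  Q = suc (qOf (nR G'))
  P = suc (qOf (nB G'))

  redNeighbour : Fin (nB G') → Fin (nR G')
  redNeighbour j = proj₁ (blue-not-isolated j)

  classify : Vertex → Fin (nR G') ⊎ Fin (Q + P)
  classify (r ℓ)  = inj₁ ℓ
  classify (b° j) = inj₁ (redNeighbour j)
  classify (b⋆ j) = inj₁ (redNeighbour j)
  classify (y₁ i) = inj₂ (join Q P (inj₁ i))
  classify (y₂ i) = inj₂ (join Q P (inj₁ i))
  classify (z₁ i) = inj₂ (join Q P (inj₂ i))
  classify (z₂ i) = inj₂ (join Q P (inj₂ i))

  classes : List (Fin (nR G') ⊎ Fin (Q + P))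
  classes = map classify S

  reds : List (Fin (nR G'))
  reds = mapMaybe isInj₁ classes

  gadgets : List (Fin (Q + P))
  gadgets = mapMaybe isInj₂ classes

  y₂-pendant : ∀ {u i} → Adj G u (y₂ i) → u ≡ y₁ i
  y₂-pendant {y₁ _} adj = cong y₁ (toℕ-≡ᵇ⇒≡ (subst T (∨-identityʳ _) adj))
  y₂-pendant {r _}  ()
  y₂-pendant {b° _} ()
  y₂-pendant {b⋆ _} ()
  y₂-pendant {y₂ _} ()
  y₂-pendant {z₁ _} ()
  y₂-pendant {z₂ _} ()

  z₂-pendant : ∀ {u i} → Adj G u (z₂ i) → u ≡ z₁ i
  z₂-pendant {z₁ _} adj = cong z₁ (toℕ-≡ᵇ⇒≡ (subst T (∨-identityʳ _) adj))
  z₂-pendant {r _}  ()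
  z₂-pendant {b° _} ()
  z₂-pendant {b⋆ _} ()
  z₂-pendant {y₁ _} ()
  z₂-pendant {y₂ _} ()
  z₂-pendant {z₂ _} ()

  gadgets-complete : Dominating G S → ∀ x → x ∈ gadgets
  gadgets-complete dom x =
    ∈-mapMaybe⁺ isInj₂ (subst (λ x → inj₂ x ∈ classes) (join-splitAt Q P x) (hit (splitAt Q x))) refl
    where
    class? : ∀ c → Decidable (λ w → c ≡ classify w)
    class? c w = Sum.≡-dec _≟ᶠ_ _≟ᶠ_ c (classify w)
    hit : ∀ c → inj₂ (join Q P c) ∈ classes
    hit (inj₁ i) = Any.map⁺ (dominating⇒meets G dom (class? _) {y₂ i} refl
                                               (cong classify ∘ sym ∘ y₂-pendant))
    hit (inj₂ i) = Any.map⁺ (dominating⇒meets G dom (class? _) {z₂ i} refl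
                                               (cong classify ∘ sym ∘ z₂-pendant))

  reds-length : ∀ {k'} → Dominating G S → length S ≤ constructK G' k' → length reds ≤ k'
  reds-length {k'} dom S-length = +-cancelʳ-≤ (Q + P) (length reds) k' (begin
    length reds + (Q + P)          ≤⟨ +-monoʳ-≤ (length reds) (∀∈⇒≤length (gadgets-complete dom)) ⟩
    length reds + length gadgets   ≡⟨ sym (length-mapMaybe-isInj classes) ⟩
    length classes                 ≡⟨ length-map classify S ⟩
    length S                       ≤⟨ S-length ⟩
    k' + Q + P                     ≡⟨ +-assoc k' Q P ⟩
    k' + (Q + P)                   ∎)
    where open ≤-Reasoning

  -- Covers j holds at b°_j, at b⋆_j and at every vertex on which their adjacencies differ.
  Covers : Fin (nB G') → Vertex → Set
  Covers j w = Maybe.Any (λ ℓ → T (E G' ℓ j)) (isInj₁ (classify w))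

  twins-agree-off : ∀ j w → ¬ Covers j w → AgreeAt G w (b° j) (b⋆ j)
  twins-agree-off j (r ℓ) ¬covers = (λ _ → ¬T⇒T-not (¬covers ∘ Maybe.just)) , (λ _ → _)
  twins-agree-off j (b° _) _ = id , id
  twins-agree-off j (b⋆ _) _ = id , id
  twins-agree-off j (y₁ _) _ = id , id
  twins-agree-off j (y₂ _) _ = id , id
  twins-agree-off j (z₁ fzero) _ = id , id
  twins-agree-off j (z₁ (fsuc _)) _ = id , id
  twins-agree-off j (z₂ _) _ = id , id

  reds-dominate : Locating G S → ∀ j → ∃ λ ℓ → ℓ ∈ reds × T (E G' ℓ j)
  reds-dominate loc j = find (Any.mapMaybe⁺ isInj₁ classes (Any.map⁺ (Any.map⁺ S-covers)))
    where
    covers? : Decidable (Covers j)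
    covers? w = Maybe.dec (λ ℓ → T? (E G' ℓ j)) (isInj₁ (classify w))
    twin-covers : Covers j (b° j)
    twin-covers = Maybe.just (proj₂ (blue-not-isolated j))
    S-covers : Any (Covers j) S
    S-covers = locating⇒meets G loc covers? (λ ()) twin-covers twin-covers (twins-agree-off j)

  reds-isRBDS : ∀ {k'} → IsLDS G S (constructK G' k') → IsRBDS G' (deduplicate _≟ᶠ_ reds) k'
  reds-isRBDS (_ , S-length , dom , loc) =
    deduplicate-! _≟ᶠ_ reds ,
    ≤-trans (length-deduplicate _≟ᶠ_ reds) (reds-length dom S-length) ,
    λ j → let ℓ , ℓ∈reds , ℓj = reds-dominate loc j in
          ℓ , ∈-deduplicate⁺ _≟ᶠ_ ℓ∈reds , ℓj

lemma23 : (G' : BipGraph) (k' : ℕ) → NoIsolated G' →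
    RBDSYes G' k' ⇔ LDSYes (construct G') (constructK G' k')
lemma23 G' k' (_ , blue-not-isolated) = mk⇔
  (λ (S' , S'-unique , S'-length , S'-dominates) →
     Forward.S G' S' , Forward.S-isLDS G' S' S'-dominates S'-unique S'-length)
  (λ (S , S-isLDS) → _ , Backward.reds-isRBDS G' blue-not-isolated S S-isLDS)
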